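{- Let $G=(L\cup R,E)$ be a bipartite graph, let $\ell,r$ be positive integers, and let $M$ be a maximal $b$-matching in $G$ with capacities $b_v=\ell$ for all $v\in L$ and $b_v=r$ for all $v\in R$. Then $|M|\ge\mu(G)\cdot\frac{\ell\cdot r}{\ell+r}$.
   Context: $\mu(G)$ is the maximum cardinality of a matching in $G$. A $b$-matching with capacities $\{b_v\}$ is a multiset $F$ of edges of $E$ (an edge may appear several times) such that each vertex $v$ is incident to at most $b_v$ elements of $F$ (counted with multiplicity); $|F|$ counts multiplicity. It is maximal if no further copy of any edge can be added without violating some capacity. -}

module Defs where

open import Data.Nat using (ℕ; zero; suc; _+_; _*_; _≤_)
open import Data.Bool using (Bool; true; false)
open import Data.Fin as F using (Fin)
open import Relation.Nullary using (yes; no; ¬_)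
open import Data.Product using (_×_; Σ-syntax)
open import Data.Sum using (_⊎_)
open import Relation.Binary.PropositionalEquality using (_≡_)

Σᶠ : (n : ℕ) → (Fin n → ℕ) → ℕ
Σᶠ zero    f = 0
Σᶠ (suc n) f = f F.zero + Σᶠ n (λ i → f (F.suc i))

record BipGraph : Set where
  field
    nL nR : ℕ
    E     : Fin nL → Fin nR → Bool

open BipGraph public

-- A multiset of edges: multiplicity of each pair, zero on non-edges.
EdgeMultiset : BipGraph → Set
EdgeMultiset G = Fin (nL G) → Fin (nR G) → ℕ

Supported : (G : BipGraph) → EdgeMultiset G → Set
Supported G m = ∀ u v → E G u v ≡ false → m u v ≡ 0

degL : (G : BipGraph) → EdgeMultiset G → Fin (nL G) → ℕ
degL G m u = Σᶠ (nR G) (λ v → m u v)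

degR : (G : BipGraph) → EdgeMultiset G → Fin (nR G) → ℕ
degR G m v = Σᶠ (nL G) (λ u → m u v)

size : (G : BipGraph) → EdgeMultiset G → ℕ
size G m = Σᶠ (nL G) (λ u → degL G m u)

IsBMatching : (G : BipGraph) → ℕ → ℕ → EdgeMultiset G → Set
IsBMatching G ℓ r m =
  Supported G m × (∀ u → degL G m u ≤ ℓ) × (∀ v → degR G m v ≤ r)

addEdge : (G : BipGraph) → EdgeMultiset G → Fin (nL G) → Fin (nR G) → EdgeMultiset G
addEdge G m u v u' v' with F._≟_ u u' | F._≟_ v v'
... | yes _ | yes _ = suc (m u' v')
... | _ | _ = m u' v'

IsMaximalBMatching : (G : BipGraph) → ℕ → ℕ → EdgeMultiset G → Set
IsMaximalBMatching G ℓ r m =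
  IsBMatching G ℓ r m ×
  (∀ u v → E G u v ≡ true → ¬ IsBMatching G ℓ r (addEdge G m u v))

IsMatching : (G : BipGraph) → EdgeMultiset G → Set
IsMatching G m = IsBMatching G 1 1 m × (∀ u v → m u v ≤ 1)

-- a maximum matching: a matching of largest size; μ(G) = its size
IsMaximumMatching : (G : BipGraph) → EdgeMultiset G → Set
IsMaximumMatching G m = IsMatching G m × (∀ n → IsMatching G n → size G n ≤ size G m)

-- By maximality of M every edge of G has an endpoint whose capacity is exhausted, so the
-- full vertices A ⊆ L and B ⊆ R form a vertex cover and μ(G) ≤ |A| + |B|.  Each vertex of A
-- meets ℓ edges of M and each vertex of B meets r, so ℓ|A| ≤ |M| and r|B| ≤ |M|; hence
-- μ(G)·ℓr ≤ (ℓ|A|)·r + (r|B|)·ℓ ≤ |M|·(ℓ + r).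
module Submission where

open import Defs
open import Data.Nat using (ℕ; zero; suc; _+_; _*_; _≤_; _<_; _≤?_; z≤n; NonZero)
open import Data.Nat.Properties
open import Data.Fin as F using (Fin)
open import Data.Fin.Properties using () renaming (suc-injective to Fin-suc-injective)
open import Data.Bool using (true; false)
open import Data.Product using (_,_)
open import Data.Sum using (_⊎_; inj₁; inj₂)
open import Function using (_∘_)
open import Relation.Nullary using (yes; no; contradiction)
open import Relation.Binary.PropositionalEquality
open import Data.Nat.Tactic.RingSolver using (solve-∀)
open import Algebra.Properties.CommutativeMonoid.Sum +-0-commutativeMonoid
  using (sum; sum-cong-≗; ∑-distrib-+; ∑-comm)
open import Algebra.Properties.Semiring.Sum +-*-semiring
  using (*-distribˡ-sum; *-distribʳ-sum)

Σᶠ≡sum : ∀ n (f : Fin n → ℕ) → Σᶠ n f ≡ sum f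
Σᶠ≡sum zero    f = refl
Σᶠ≡sum (suc n) f = cong (f F.zero +_) (Σᶠ≡sum n (f ∘ F.suc))

Σᶠ-cong : ∀ n {f g : Fin n → ℕ} → (∀ i → f i ≡ g i) → Σᶠ n f ≡ Σᶠ n g
Σᶠ-cong n {f} {g} f≗g = begin
  Σᶠ n f ≡⟨ Σᶠ≡sum n f ⟩
  sum f  ≡⟨ sum-cong-≗ f≗g ⟩
  sum g  ≡⟨ Σᶠ≡sum n g ⟨
  Σᶠ n g ∎
  where open ≡-Reasoning

Σᶠ-distrib-+ : ∀ n (f g : Fin n → ℕ) → Σᶠ n (λ i → f i + g i) ≡ Σᶠ n f + Σᶠ n g
Σᶠ-distrib-+ n f g = begin
  Σᶠ n (λ i → f i + g i) ≡⟨ Σᶠ≡sum n _ ⟩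
  sum (λ i → f i + g i)  ≡⟨ ∑-distrib-+ f g ⟩
  sum f + sum g          ≡⟨ cong₂ _+_ (Σᶠ≡sum n f) (Σᶠ≡sum n g) ⟨
  Σᶠ n f + Σᶠ n g        ∎
  where open ≡-Reasoning

*-distribˡ-Σᶠ : ∀ n c (f : Fin n → ℕ) → c * Σᶠ n f ≡ Σᶠ n (λ i → c * f i)
*-distribˡ-Σᶠ n c f = begin
  c * Σᶠ n f           ≡⟨ cong (c *_) (Σᶠ≡sum n f) ⟩
  c * sum f            ≡⟨ *-distribˡ-sum c f ⟩
  sum (λ i → c * f i)  ≡⟨ Σᶠ≡sum n _ ⟨
  Σᶠ n (λ i → c * f i) ∎
  where open ≡-Reasoning

*-distribʳ-Σᶠ : ∀ n c (f : Fin n → ℕ) → Σᶠ n f * c ≡ Σᶠ n (λ i → f i * c)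
*-distribʳ-Σᶠ n c f = begin
  Σᶠ n f * c           ≡⟨ cong (_* c) (Σᶠ≡sum n f) ⟩
  sum f * c            ≡⟨ *-distribʳ-sum c f ⟩
  sum (λ i → f i * c)  ≡⟨ Σᶠ≡sum n _ ⟨
  Σᶠ n (λ i → f i * c) ∎
  where open ≡-Reasoning

Σᶠ-comm : ∀ m n (f : Fin m → Fin n → ℕ) →
  Σᶠ m (λ i → Σᶠ n (f i)) ≡ Σᶠ n (λ j → Σᶠ m (λ i → f i j))
Σᶠ-comm m n f = begin
  Σᶠ m (λ i → Σᶠ n (f i))              ≡⟨ Σᶠ-cong m (λ i → Σᶠ≡sum n (f i)) ⟩
  Σᶠ m (λ i → sum (f i))               ≡⟨ Σᶠ≡sum m _ ⟩
  sum (λ i → sum (f i))                ≡⟨ ∑-comm f ⟩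
  sum (λ j → sum (λ i → f i j))        ≡⟨ Σᶠ≡sum n _ ⟨
  Σᶠ n (λ j → sum (λ i → f i j))       ≡⟨ Σᶠ-cong n (λ j → Σᶠ≡sum m (λ i → f i j)) ⟨
  Σᶠ n (λ j → Σᶠ m (λ i → f i j))      ∎
  where open ≡-Reasoning

Σᶠ-mono-≤ : ∀ n {f g : Fin n → ℕ} → (∀ i → f i ≤ g i) → Σᶠ n f ≤ Σᶠ n g
Σᶠ-mono-≤ zero    f≤g = z≤n
Σᶠ-mono-≤ (suc n) f≤g = +-mono-≤ (f≤g F.zero) (Σᶠ-mono-≤ n (f≤g ∘ F.suc))

Σᶠ-mono-≤-suc : ∀ {n} (j : Fin n) {f g : Fin n → ℕ} →
  (∀ i → i ≢ j → f i ≤ g i) → f j ≤ suc (g j) → Σᶠ n f ≤ suc (Σᶠ n g)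
Σᶠ-mono-≤-suc {suc n} F.zero    f≤g fj≤ = +-mono-≤ fj≤ (Σᶠ-mono-≤ n (λ i → f≤g (F.suc i) λ ()))
Σᶠ-mono-≤-suc {suc n} (F.suc j) {f} {g} f≤g fj≤ = begin
  f F.zero + Σᶠ n (f ∘ F.suc)        ≤⟨ +-mono-≤ (f≤g F.zero λ ()) (Σᶠ-mono-≤-suc j f∘suc≤g∘suc fj≤) ⟩
  g F.zero + suc (Σᶠ n (g ∘ F.suc))  ≡⟨ +-suc (g F.zero) _ ⟩
  suc (g F.zero + Σᶠ n (g ∘ F.suc))  ∎
  where
  open ≤-Reasoning
  f∘suc≤g∘suc : ∀ i → i ≢ j → f (F.suc i) ≤ g (F.suc i)
  f∘suc≤g∘suc i i≢j = f≤g (F.suc i) (i≢j ∘ Fin-suc-injective)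

Σᶠ-*-≤ : ∀ n {d : Fin n → ℕ} (x : Fin n → ℕ) → (∀ i → d i ≤ 1) →
  Σᶠ n (λ i → d i * x i) ≤ Σᶠ n x
Σᶠ-*-≤ n x d≤1 =
  Σᶠ-mono-≤ n (λ i → ≤-trans (*-monoˡ-≤ (x i) (d≤1 i)) (≤-reflexive (*-identityˡ (x i))))

full : ℕ → ℕ → ℕ
full c d with c ≤? d
... | yes _ = 1
... | no _  = 0

full≡1 : ∀ {c d} → c ≤ d → full c d ≡ 1
full≡1 {c} {d} c≤d with c ≤? d
... | yes _  = refl
... | no c≰d = contradiction c≤d c≰d

*-full-≤ : ∀ c d → c * full c d ≤ d
*-full-≤ c d with c ≤? d
... | yes c≤d = ≤-trans (≤-reflexive (*-identityʳ c)) c≤d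
... | no _    = ≤-trans (≤-reflexive (*-zeroʳ c)) z≤n

*-Σᶠ-full-≤ : ∀ n c (d : Fin n → ℕ) → c * Σᶠ n (λ i → full c (d i)) ≤ Σᶠ n d
*-Σᶠ-full-≤ n c d =
  ≤-trans (≤-reflexive (*-distribˡ-Σᶠ n c _)) (Σᶠ-mono-≤ n (λ i → *-full-≤ c (d i)))

cover-weights-bound : ∀ {n a b s} ℓ r → n ≤ a + b → ℓ * a ≤ s → r * b ≤ s →
  n * (ℓ * r) ≤ s * (ℓ + r)
cover-weights-bound {n} {a} {b} {s} ℓ r n≤a+b ℓa≤s rb≤s = begin
  n * (ℓ * r)               ≤⟨ *-monoˡ-≤ (ℓ * r) n≤a+b ⟩
  (a + b) * (ℓ * r)         ≡⟨ regroup a b ℓ r ⟩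
  ℓ * a * r + r * b * ℓ     ≤⟨ +-mono-≤ (*-monoˡ-≤ r ℓa≤s) (*-monoˡ-≤ ℓ rb≤s) ⟩
  s * r + s * ℓ             ≡⟨ collect s ℓ r ⟩
  s * (ℓ + r)               ∎
  where
  open ≤-Reasoning
  regroup : ∀ a b ℓ r → (a + b) * (ℓ * r) ≡ ℓ * a * r + r * b * ℓ
  regroup = solve-∀
  collect : ∀ s ℓ r → s * r + s * ℓ ≡ s * (ℓ + r)
  collect = solve-∀

module _ (G : BipGraph) where

  size≡Σᶠ-degR : (m : EdgeMultiset G) → size G m ≡ Σᶠ (nR G) (degR G m)
  size≡Σᶠ-degR m = Σᶠ-comm (nL G) (nR G) m

  module _ (m : EdgeMultiset G) (u : Fin (nL G)) (v : Fin (nR G)) where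

    addEdge-≤-suc : ∀ u′ v′ → addEdge G m u v u′ v′ ≤ suc (m u′ v′)
    addEdge-≤-suc u′ v′ with u F.≟ u′ | v F.≟ v′
    ... | yes _ | yes _ = ≤-refl
    ... | yes _ | no _  = n≤1+n _
    ... | no _  | _     = n≤1+n _

    addEdge-elsewhere : ∀ u′ v′ → u ≢ u′ ⊎ v ≢ v′ → addEdge G m u v u′ v′ ≡ m u′ v′
    addEdge-elsewhere u′ v′ elsewhere with u F.≟ u′ | v F.≟ v′ | elsewhere
    ... | yes u≡u′ | yes _    | inj₁ u≢u′ = contradiction u≡u′ u≢u′
    ... | yes _    | yes v≡v′ | inj₂ v≢v′ = contradiction v≡v′ v≢v′
    ... | yes _    | no _     | _         = refl
    ... | no _     | _        | _         = refl

    addEdge-supported : E G u v ≡ true → Supported G m → Supported G (addEdge G m u v)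
    addEdge-supported uv∈E supp u′ v′ u′v′∉E with u F.≟ u′ | v F.≟ v′
    ... | yes refl | yes refl = contradiction (trans (sym uv∈E) u′v′∉E) λ ()
    ... | yes _    | no _     = supp u′ v′ u′v′∉E
    ... | no _     | _        = supp u′ v′ u′v′∉E

    addEdge-degL-≤ : ∀ {ℓ} → (∀ u′ → degL G m u′ ≤ ℓ) → degL G m u < ℓ →
      ∀ u′ → degL G (addEdge G m u v) u′ ≤ ℓ
    addEdge-degL-≤ bounded room u′ with u′ F.≟ u
    ... | yes refl = ≤-trans (Σᶠ-mono-≤-suc v elsewhere (addEdge-≤-suc u v)) room
      where
      elsewhere : ∀ v′ → v′ ≢ v → addEdge G m u v u v′ ≤ m u v′
      elsewhere v′ v′≢v = ≤-reflexive (addEdge-elsewhere u v′ (inj₂ (≢-sym v′≢v)))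
    ... | no u′≢u = ≤-trans (Σᶠ-mono-≤ (nR G) elsewhere) (bounded u′)
      where
      elsewhere : ∀ v′ → addEdge G m u v u′ v′ ≤ m u′ v′
      elsewhere v′ = ≤-reflexive (addEdge-elsewhere u′ v′ (inj₁ (≢-sym u′≢u)))

    addEdge-degR-≤ : ∀ {r} → (∀ v′ → degR G m v′ ≤ r) → degR G m v < r →
      ∀ v′ → degR G (addEdge G m u v) v′ ≤ r
    addEdge-degR-≤ bounded room v′ with v′ F.≟ v
    ... | yes refl = ≤-trans (Σᶠ-mono-≤-suc u elsewhere (addEdge-≤-suc u v)) room
      where
      elsewhere : ∀ u′ → u′ ≢ u → addEdge G m u v u′ v ≤ m u′ v
      elsewhere u′ u′≢u = ≤-reflexive (addEdge-elsewhere u′ v (inj₁ (≢-sym u′≢u)))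
    ... | no v′≢v = ≤-trans (Σᶠ-mono-≤ (nL G) elsewhere) (bounded v′)
      where
      elsewhere : ∀ u′ → addEdge G m u v u′ v′ ≤ m u′ v′
      elsewhere u′ = ≤-reflexive (addEdge-elsewhere u′ v′ (inj₂ (≢-sym v′≢v)))

  maximal⇒endpoint-full : ∀ {ℓ r} {m : EdgeMultiset G} → IsMaximalBMatching G ℓ r m →
    ∀ u v → E G u v ≡ true → ℓ ≤ degL G m u ⊎ r ≤ degR G m v
  maximal⇒endpoint-full {ℓ} {r} {m} ((supp , degL≤ , degR≤) , maximal) u v uv∈E
    with ℓ ≤? degL G m u | r ≤? degR G m v
  ... | yes ℓ≤ | _      = inj₁ ℓ≤
  ... | no _   | yes r≤ = inj₂ r≤
  ... | no ℓ≰  | no r≰  = contradiction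
        ( addEdge-supported m u v uv∈E supp
        , addEdge-degL-≤ m u v degL≤ (≰⇒> ℓ≰)
        , addEdge-degR-≤ m u v degR≤ (≰⇒> r≰) )
        (maximal u v uv∈E)

  matching-size≤cover : (m : EdgeMultiset G) → Supported G m →
    (∀ u → degL G m u ≤ 1) → (∀ v → degR G m v ≤ 1) →
    (x : Fin (nL G) → ℕ) (y : Fin (nR G) → ℕ) → (∀ u v → E G u v ≡ true → 1 ≤ x u + y v) →
    size G m ≤ Σᶠ (nL G) x + Σᶠ (nR G) y
  matching-size≤cover m supp degL≤1 degR≤1 x y cover = begin
    Σᶠ nl (λ u → Σᶠ nr (m u))
      ≤⟨ Σᶠ-mono-≤ nl (λ u → Σᶠ-mono-≤ nr (covered u)) ⟩
    Σᶠ nl (λ u → Σᶠ nr (λ v → m u v * x u + m u v * y v))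
      ≡⟨ Σᶠ-cong nl (λ u → Σᶠ-distrib-+ nr _ _) ⟩
    Σᶠ nl (λ u → Σᶠ nr (λ v → m u v * x u) + Σᶠ nr (λ v → m u v * y v))
      ≡⟨ Σᶠ-distrib-+ nl _ _ ⟩
    Σᶠ nl (λ u → Σᶠ nr (λ v → m u v * x u)) + Σᶠ nl (λ u → Σᶠ nr (λ v → m u v * y v))
      ≡⟨ cong₂ _+_ (Σᶠ-cong nl (λ u → *-distribʳ-Σᶠ nr (x u) (m u)))
                   (sym (Σᶠ-comm nl nr (λ u v → m u v * y v))) ⟨
    Σᶠ nl (λ u → degL G m u * x u) + Σᶠ nr (λ v → Σᶠ nl (λ u → m u v * y v))
      ≡⟨ cong (Σᶠ nl (λ u → degL G m u * x u) +_)
              (Σᶠ-cong nr (λ v → *-distribʳ-Σᶠ nl (y v) (λ u → m u v))) ⟨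
    Σᶠ nl (λ u → degL G m u * x u) + Σᶠ nr (λ v → degR G m v * y v)
      ≤⟨ +-mono-≤ (Σᶠ-*-≤ nl x degL≤1) (Σᶠ-*-≤ nr y degR≤1) ⟩
    Σᶠ nl x + Σᶠ nr y ∎
    where
    open ≤-Reasoning
    nl nr : ℕ
    nl = nL G
    nr = nR G
    covered : ∀ u v → m u v ≤ m u v * x u + m u v * y v
    covered u v with E G u v in E-uv
    ... | false rewrite supp u v E-uv = z≤n
    ... | true = begin
      m u v                         ≡⟨ *-identityʳ (m u v) ⟨
      m u v * 1                     ≤⟨ *-monoʳ-≤ (m u v) (cover u v E-uv) ⟩
      m u v * (x u + y v)           ≡⟨ *-distribˡ-+ (m u v) (x u) (y v) ⟩
      m u v * x u + m u v * y v     ∎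

lemma3p2 : (G : BipGraph) (ℓ r : ℕ) → .{{_ : NonZero ℓ}} → .{{_ : NonZero r}} →
    (M : EdgeMultiset G) → IsMaximalBMatching G ℓ r M →
    (N : EdgeMultiset G) → IsMaximumMatching G N →
    size G N * (ℓ * r) ≤ size G M * (ℓ + r)
lemma3p2 G ℓ r M maximal N (((suppN , degL≤1 , degR≤1) , _) , _) =
  cover-weights-bound ℓ r
    (matching-size≤cover G N suppN degL≤1 degR≤1 fullL fullR full-cover)
    (*-Σᶠ-full-≤ (nL G) ℓ (degL G M))
    (subst (r * Σᶠ (nR G) fullR ≤_) (sym (size≡Σᶠ-degR G M))
      (*-Σᶠ-full-≤ (nR G) r (degR G M)))
  where
  fullL : Fin (nL G) → ℕ
  fullL u = full ℓ (degL G M u)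
  fullR : Fin (nR G) → ℕ
  fullR v = full r (degR G M v)
  full-cover : ∀ u v → E G u v ≡ true → 1 ≤ fullL u + fullR v
  full-cover u v uv∈E with maximal⇒endpoint-full G maximal u v uv∈E
  ... | inj₁ ℓ≤ = ≤-trans (≤-reflexive (sym (full≡1 ℓ≤))) (m≤m+n (fullL u) (fullR v))
  ... | inj₂ r≤ = ≤-trans (≤-reflexive (sym (full≡1 r≤))) (m≤n+m (fullR v) (fullL u))
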